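{- Let $\lambda=(\lambda_1\ge\dots\ge\lambda_n\ge0)$ be a partition and $v\in B_n\lambda$. There is exactly one key tableau $K(v)$ whose weight is $v$, and its shape is $\lambda$. Moreover, $K(\lambda)$ is the only KN tableau of shape $\lambda$ and weight $\lambda$.
   Context: $[\pm n]=\{1,\dots,n,\overline n,\dots,\overline1\}$ ($\overline i=-i$), ordered $1<\dots<n<\overline n<\dots<\overline1$. A column is admissible if whenever $i,\overline i$ both occur, with $i$ in row $a$ from the top and $\overline i$ in row $b$ from the bottom, $a+b\le i$; for admissible $C$ with $z_1>\dots>z_r$ the $z\in[n]$ such that $z,\overline z\in C$, define $t_1$ the greatest $t\in[n]$ with $t<z_1$, $t,\overline t\notin C$, and $t_k$ the greatest $t\in[n]$ with $t<\min(t_{k-1},z_k)$, $t,\overline t\notin C$; $rC$ (resp. $\ell C$) replaces each $\overline{z_k}$ by $\overline{t_k}$ (resp. $z_k$ by $t_k$) and reorders. A KN tableau is a semistandard tableau (rows weakly, columns strictly increasing) with admissible columns such that replacing each column $C$ by $\ell C\,rC$ is semistandard. Weight: $i$-th entry is the number of $i$'s minus the number of $\overline i$'s. A key tableau is a KN tableau of partition shape in which the entry set of each column contains that of the next column to its right and no $i$ has both $i,\overline i$ as entries. $B_n$ (signed permutations) acts on $\mathbb Z^n$ generated by $s_i$ ($i<n$) swapping entries $i,i+1$ and $s_n$ negating the last entry; $B_n\lambda$ is the orbit of $\lambda$. -}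

module Defs where

open import Data.Nat using (ℕ; zero; suc; _+_; _∸_; _≤_; _<_; _⊔_; _⊓_; _<ᵇ_)
open import Data.Bool using (Bool; true; false; _∧_; not; if_then_else_)
open import Data.Fin using (Fin; toℕ) renaming (_≟_ to _≟F_)
open import Data.List using (List; []; _∷_; length; map; filterᵇ; allFin; upTo; reverse; concat; last; lookup; _++_)
open import Data.Bool.ListAction using (any)
open import Data.List.Relation.Unary.All using (All)
open import Data.List.Relation.Unary.Linked using (Linked)
open import Data.Vec using (Vec; []; _∷_; tabulate; toList) renaming (map to vmap; lookup to vlookup)
open import Data.Integer using (ℤ; -_)
open import Data.Integer as ℤ using () renaming (+_ to ofℕ) renaming (_-_ to _-ℤ_)
open import Data.Maybe using (Maybe; just; nothing)
open import Data.Product using (_×_; Σ; _,_)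
open import Data.Unit using (⊤)
open import Data.Empty using (⊥)
open import Relation.Nullary using (¬_; does; yes; no)
open import Relation.Binary.PropositionalEquality using (_≡_; refl; cong)

-- The alphabet [±n].  pos i stands for the letter (toℕ i + 1),
-- neg i for its bar.  Order 1 < ... < n < n̄ < ... < 1̄ via a rank.

data Letter (n : ℕ) : Set where
  pos : Fin n → Letter n
  neg : Fin n → Letter n

rank : ∀ {n} → Letter n → ℕ
rank     (pos i) = toℕ i
rank {n} (neg i) = n + (n ∸ suc (toℕ i))

_<L_ : ∀ {n} → Letter n → Letter n → Set
x <L y = rank x < rank y

_≤L_ : ∀ {n} → Letter n → Letter n → Set
x ≤L y = rank x ≤ rank y

_==L_ : ∀ {n} → Letter n → Letter n → Bool
pos i ==L pos j = does (i ≟F j)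
neg i ==L neg j = does (i ≟F j)
_     ==L _     = false

_∈ᵇ_ : ∀ {n} → Letter n → List (Letter n) → Bool
x ∈ᵇ C = any (x ==L_) C

Column : ℕ → Set
Column n = List (Letter n)

-- a tableau is given by its list of columns (left to right),
-- each column listed from top to bottom
Tableau : ℕ → Set
Tableau n = List (Column n)

-- Admissible columns: if i (row a from the top, 1-based) and ī (row b
-- from the bottom, 1-based) both occur, then a + b ≤ i.

Admissible : ∀ {n} → Column n → Set
Admissible {n} C =
  (p q : Fin (length C)) (i : Fin n) →
  lookup C p ≡ pos i → lookup C q ≡ neg i →
  suc (toℕ p) + (length C ∸ toℕ q) ≤ suc (toℕ i)

allLetters : (n : ℕ) → List (Letter n)
allLetters n = map pos (allFin n) ++ map neg (reverse (allFin n))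

reorder : ∀ {n} → Column n → Column n
reorder {n} C = filterᵇ (_∈ᵇ C) (allLetters n)

zs : ∀ {n} → Column n → List (Fin n)
zs {n} C = reverse (filterᵇ (λ z → (pos z ∈ᵇ C) ∧ (neg z ∈ᵇ C)) (allFin n))

greatestFree : ∀ {n} → Column n → ℕ → Maybe (Fin n)
greatestFree {n} C b =
  last (filterᵇ (λ t → (toℕ t <ᵇ b) ∧ not (pos t ∈ᵇ C) ∧ not (neg t ∈ᵇ C)) (allFin n))

-- t₁, ..., t_r (bound: previous t, initially n, which exceeds every z)
tsFrom : ∀ {n} → Column n → ℕ → List (Fin n) → Maybe (List (Fin n))
tsFrom C b [] = just []
tsFrom C b (z ∷ zs') with greatestFree C (b ⊓ toℕ z)
... | nothing = nothing
... | just t with tsFrom C (toℕ t) zs'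
...   | nothing = nothing
...   | just ts = just (t ∷ ts)

ts : ∀ {n} → Column n → Maybe (List (Fin n))
ts {n} C = tsFrom C n (zs C)

assoc : ∀ {n} → List (Fin n) → List (Fin n) → Fin n → Fin n
assoc []       _        x = x
assoc (_ ∷ _)  []       x = x
assoc (z ∷ zs') (t ∷ ts') x = if does (x ≟F z) then t else assoc zs' ts' x

rCol : ∀ {n} → Column n → Maybe (Column n)
rCol C with ts C
... | nothing = nothing
... | just tl = just (reorder (map f C))
  where
  f : _ → _
  f (pos i) = pos i
  f (neg i) = neg (assoc (zs C) tl i)

lCol : ∀ {n} → Column n → Maybe (Column n)
lCol C with ts C
... | nothing = nothing
... | just tl = just (reorder (map f C))
  where
  f : _ → _
  f (pos i) = pos (assoc (zs C) tl i)
  f (neg i) = neg i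

RowLeq : ∀ {n} → Column n → Column n → Set
RowLeq C       []       = ⊤
RowLeq []      (_ ∷ _)  = ⊥
RowLeq (c ∷ C) (d ∷ D)  = c ≤L d × RowLeq C D

NonEmpty : ∀ {n} → Column n → Set
NonEmpty []      = ⊥
NonEmpty (_ ∷ _) = ⊤

-- partition shape (nonempty columns of weakly decreasing length),
-- columns strictly increasing, rows weakly increasing
Semistandard : ∀ {n} → Tableau n → Set
Semistandard T = All NonEmpty T × All (Linked _<L_) T × Linked RowLeq T

splitTableau : ∀ {n} → Tableau n → Maybe (Tableau n)
splitTableau [] = just []
splitTableau (C ∷ T) with lCol C | rCol C | splitTableau T
... | just L | just R | just T' = just (L ∷ R ∷ T')
... | _      | _      | _       = nothing

IsKN : ∀ {n} → Tableau n → Set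
IsKN T = Semistandard T × All Admissible T ×
         Σ _ (λ T' → splitTableau T ≡ just T' × Semistandard T')

count : ∀ {n} → Letter n → Tableau n → ℕ
count x T = length (filterᵇ (x ==L_) (concat T))

weight : ∀ {n} → Tableau n → Vec ℤ n
weight T = tabulate (λ i → ofℕ (count (pos i) T) -ℤ ofℕ (count (neg i) T))

IsPartition : ∀ {n} → Vec ℕ n → Set
IsPartition {n} λ' = (i j : Fin n) → toℕ i ≤ toℕ j → vlookup λ' j ≤ vlookup λ' i

-- column lengths of the Young diagram of λ (its conjugate)
conjugate : ∀ {n} → Vec ℕ n → List ℕ
conjugate λ' = map (λ j → length (filterᵇ (j <ᵇ_) (toList λ'))) (upTo (Data.Vec.foldr _ _⊔_ 0 λ'))
  where import Data.Vec

HasShape : ∀ {n} → Tableau n → Vec ℕ n → Set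
HasShape T λ' = map length T ≡ conjugate λ'

_⊆ᶜ_ : ∀ {n} → Column n → Column n → Set
D ⊆ᶜ C = All (λ x → x ∈ᵇ C ≡ true) D

ColsNested : ∀ {n} → Tableau n → Set
ColsNested T = Linked (λ C D → D ⊆ᶜ C) T

IsKey : ∀ {n} → Tableau n → Set
IsKey {n} T = IsKN T × ColsNested T ×
  ((i : Fin n) → ¬ ((pos i ∈ᵇ concat T ≡ true) × (neg i ∈ᵇ concat T ≡ true)))

-- s_{k+1}: swap entries k+1, k+2 (identity if out of range)
swapAt : ∀ {n} → ℕ → Vec ℤ n → Vec ℤ n
swapAt zero    (x ∷ y ∷ xs) = y ∷ x ∷ xs
swapAt (suc k) (x ∷ xs)     = x ∷ swapAt k xs
swapAt _       xs           = xs

negLast : ∀ {n} → Vec ℤ n → Vec ℤ n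
negLast []           = []
negLast (x ∷ [])     = (- x) ∷ []
negLast (x ∷ y ∷ xs) = x ∷ negLast (y ∷ xs)

-- v ∈ Bₙ w : the orbit, as closure under the generators
data InOrbit {n : ℕ} (w : Vec ℤ n) : Vec ℤ n → Set where
  here  : InOrbit w w
  swap  : ∀ {v} (k : ℕ) → suc k Data.Nat.< n → InOrbit w v → InOrbit w (swapAt k v)
  flip  : ∀ {v} → InOrbit w v → InOrbit w (negLast v)

toℤ : ∀ {n} → Vec ℕ n → Vec ℤ n
toℤ = vmap (λ k → ofℕ k)

-- A key tableau has nested columns and never contains both i and ī, so it is determined by its
-- content, and the content is read off from the weight v: i occurs v_i⁺ times and ī occurs v_i⁻
-- times.  Its j-th column is then the set of letters occurring more than j times.  Conversely this
-- tableau is semistandard, and since no column contains a pair z, z̄ the split ℓC rC is just C C,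
-- so it is KN.  Its j-th column has as many entries as there are i with |v_i| > j, which is the
-- j-th column length of λ because |v| is a permutation of λ.
--
-- For the second statement let the unbarred letter i score n + 1 − i and barred letters score 0.
-- The k-th entry of a strictly increasing column is at least k, so a column of length m scores at
-- most n + (n − 1) + ⋯ + (n − m + 1), with equality only for the column 1, 2, …, m.  Summed over
-- the columns of shape λ these bounds give Σ (n + 1 − i) λ_i, whereas weight λ forces at least
-- λ_i entries i, so the score is at least that sum.  Hence every column is 1, 2, …, m.

module Submission where

open import Data.Bool using (Bool; true; false; _∧_; T; T?)
open import Data.Bool.Properties using (T-≡; T-∧; ¬-not; ∧-zeroʳ; ∧-identityʳ; ∨-zeroʳ)
open import Data.Empty using (⊥-elim)
open import Data.Fin using (Fin; toℕ) renaming (zero to fzero; suc to fsuc; _≟_ to _≟F_)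
open import Data.Fin.Properties using (toℕ-injective; toℕ<n)
open import Data.Integer using (ℤ; -[1+_]; ∣_∣) renaming (+_ to ofℕ; _-_ to _-ℤ_; _≤_ to _≤ℤ_)
import Data.Integer.Properties as ℤ
open import Data.List using (List; []; _∷_; _++_; length; map; filterᵇ; concat; reverse; allFin; tabulate; applyUpTo; upTo)
open import Data.List.Base using (reverseAcc)
open import Data.List.Membership.Propositional using (_∈_)
open import Data.List.Membership.Propositional.Properties using (∈-lookup; ∈-concat⁺′; ∈-map⁺; ∈-++⁺ˡ; ∈-++⁺ʳ; ∈-allFin)
open import Data.List.Properties
  using (filter-++; filter-none; length-filter; length-++; map-id-local; map-tabulate; map-∘; map-applyUpTo; map-++; ∷-injectiveˡ; ∷-injectiveʳ)
open import Data.List.Relation.Binary.Permutation.Propositional using (_↭_; ↭-reflexive; ↭-trans; prep) renaming (swap to ↭-swap)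
import Data.List.Relation.Binary.Permutation.Propositional.Properties as ↭
open import Data.List.Relation.Unary.All as All using (All; []; _∷_)
import Data.List.Relation.Unary.All.Properties as All
open import Data.List.Relation.Unary.Any using (here; there)
open import Data.List.Relation.Unary.Any.Properties using (reverse⁺)
open import Data.List.Relation.Unary.Linked as Linked using (Linked; []; [-]; _∷_)
import Data.List.Relation.Unary.Linked.Properties as Linked
open import Data.Maybe using (just)
open import Data.Nat using (ℕ; zero; suc; _+_; _*_; _∸_; _≤_; _<_; _≥_; _≤?_; _⊓_; _⊔_; _<ᵇ_; z≤n; s≤s; pred)
open import Data.Nat.ListAction using (sum)
open import Data.Nat.ListAction.Properties using (sum-++)
open import Data.Nat.Properties
open import Algebra.Properties.CommutativeSemigroup +-commutativeSemigroup using (interchange)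
open import Algebra.Properties.Monoid.Sum +-0-monoid using (sum-syntax; sum-cong-≗; sum-replicate-zero)
open import Algebra.Properties.CommutativeMonoid.Sum +-0-commutativeMonoid using (∑-distrib-+)
open import Data.Product using (_×_; Σ; ∃; _,_; proj₁; proj₂)
open import Data.Sum using (_⊎_; inj₁; inj₂)
open import Data.Unit using (⊤; tt)
open import Data.Vec using (Vec; []; _∷_)
import Data.Vec as Vec
import Data.Vec.Properties as Vec
open import Function using (_∘_; Equivalence; case_of_)
open import Relation.Binary using (tri<; tri≈; tri>)
open import Relation.Binary.PropositionalEquality
open import Relation.Nullary using (¬_; does; yes; no; contradiction)
open import Relation.Nullary.Decidable using (dec-true)

open import Defs

fromBool : Bool → ℕ
fromBool true  = 1
fromBool false = 0

<ᵇ≡true⇒< : ∀ {m n} → (m <ᵇ n) ≡ true → m < n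
<ᵇ≡true⇒< {m} {n} e = <ᵇ⇒< m n (Equivalence.from T-≡ e)

<⇒<ᵇ≡true : ∀ {m n} → m < n → (m <ᵇ n) ≡ true
<⇒<ᵇ≡true m<n = Equivalence.to T-≡ (<⇒<ᵇ m<n)

<ᵇ≡false⇒≥ : ∀ {m n} → (m <ᵇ n) ≡ false → n ≤ m
<ᵇ≡false⇒≥ m≮n = ≮⇒≥ λ m<n → case trans (sym (<⇒<ᵇ≡true m<n)) m≮n of λ ()

filterᵇ-cong : ∀ {A : Set} {p q : A → Bool} → (∀ x → p x ≡ q x) → ∀ xs → filterᵇ p xs ≡ filterᵇ q xs
filterᵇ-cong p≗q []       = refl
filterᵇ-cong {q = q} p≗q (x ∷ xs) rewrite p≗q x with q x
... | true  = cong (x ∷_) (filterᵇ-cong p≗q xs)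
... | false = filterᵇ-cong p≗q xs

applyUpTo-cong : ∀ {A : Set} {f g : ℕ → A} → (∀ j → f j ≡ g j) → ∀ k → applyUpTo f k ≡ applyUpTo g k
applyUpTo-cong f≗g zero    = refl
applyUpTo-cong f≗g (suc k) = cong₂ _∷_ (f≗g 0) (applyUpTo-cong (f≗g ∘ suc) k)

∸-strictʳ : ∀ {n o r} → o < n → o < r → n ∸ r < n ∸ o
∸-strictʳ {n} {o} {r} o<n o<r with r ≤? n
... | yes r≤n = ∸-monoʳ-< o<r r≤n
... | no  r≰n = subst (_< n ∸ o) (sym (m≤n⇒m∸n≡0 (<⇒≤ (≰⇒> r≰n)))) (m<n⇒0<n∸m o<n)

countᵇ : ∀ {A : Set} → (A → Bool) → List A → ℕ
countᵇ p xs = length (filterᵇ p xs)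

module _ {A : Set} where

  countᵇ-∷ : ∀ (p : A → Bool) x xs → countᵇ p (x ∷ xs) ≡ fromBool (p x) + countᵇ p xs
  countᵇ-∷ p x xs with p x
  ... | true  = refl
  ... | false = refl

  countᵇ-++ : ∀ (p : A → Bool) xs ys → countᵇ p (xs ++ ys) ≡ countᵇ p xs + countᵇ p ys
  countᵇ-++ p xs ys = trans (cong length (filter-++ (T? ∘ p) xs ys)) (length-++ (filterᵇ p xs))

  countᵇ-↭ : ∀ (p : A → Bool) {xs ys} → xs ↭ ys → countᵇ p xs ≡ countᵇ p ys
  countᵇ-↭ p xs↭ys = ↭.↭-length (↭.filter-↭ (T? ∘ p) xs↭ys)

  countᵇ-+ : ∀ {p q r : A → Bool} → (∀ x → fromBool (p x) + fromBool (q x) ≡ fromBool (r x)) →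
             ∀ xs → countᵇ p xs + countᵇ q xs ≡ countᵇ r xs
  countᵇ-+ p+q≡r [] = refl
  countᵇ-+ {p} {q} {r} p+q≡r (x ∷ xs) = begin
    countᵇ p (x ∷ xs) + countᵇ q (x ∷ xs)
      ≡⟨ cong₂ _+_ (countᵇ-∷ p x xs) (countᵇ-∷ q x xs) ⟩
    (fromBool (p x) + countᵇ p xs) + (fromBool (q x) + countᵇ q xs)
      ≡⟨ interchange (fromBool (p x)) (countᵇ p xs) (fromBool (q x)) (countᵇ q xs) ⟩
    (fromBool (p x) + fromBool (q x)) + (countᵇ p xs + countᵇ q xs)
      ≡⟨ cong₂ _+_ (p+q≡r x) (countᵇ-+ p+q≡r xs) ⟩
    fromBool (r x) + countᵇ r xs
      ≡⟨ countᵇ-∷ r x xs ⟨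
    countᵇ r (x ∷ xs) ∎
    where open ≡-Reasoning

  countᵇ-none : ∀ {p : A → Bool} {xs} → All (λ x → p x ≡ false) xs → countᵇ p xs ≡ 0
  countᵇ-none []                       = refl
  countᵇ-none {p} {x ∷ xs} (px ∷ pxs) = trans (countᵇ-∷ p x xs) (cong₂ _+_ (cong fromBool px) (countᵇ-none pxs))

countᵇ-map : ∀ {A B : Set} (p : B → Bool) (f : A → B) xs → countᵇ p (map f xs) ≡ countᵇ (p ∘ f) xs
countᵇ-map p f []       = refl
countᵇ-map p f (x ∷ xs) = trans (countᵇ-∷ p (f x) (map f xs))
  (trans (cong (fromBool (p (f x)) +_) (countᵇ-map p f xs)) (sym (countᵇ-∷ (p ∘ f) x xs)))

countᵇ-<-all≤ : ∀ {j xs} → All (_≤ j) xs → countᵇ (j <ᵇ_) xs ≡ 0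
countᵇ-<-all≤ {j} = countᵇ-none ∘ All.map (λ {y} y≤j → ¬-not λ j<y → <⇒≱ (<ᵇ≡true⇒< {j} {y} j<y) y≤j)

map-lookup-allFin : ∀ {A : Set} {m} (v : Vec A m) → map (Vec.lookup v) (allFin m) ≡ Vec.toList v
map-lookup-allFin {A} v = trans (map-tabulate (λ i → i) (Vec.lookup v)) (tabulate-lookup v)
  where
  tabulate-lookup : ∀ {m} (v : Vec A m) → tabulate (Vec.lookup v) ≡ Vec.toList v
  tabulate-lookup []       = refl
  tabulate-lookup (x ∷ v) = cong (x ∷_) (tabulate-lookup v)

sum-applyUpTo-linear : ∀ c (f g : ℕ → ℕ) M →
                       sum (applyUpTo (λ j → c * f j + g j) M) ≡ c * sum (applyUpTo f M) + sum (applyUpTo g M)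
sum-applyUpTo-linear c f g zero    = sym (cong (_+ 0) (*-zeroʳ c))
sum-applyUpTo-linear c f g (suc M) = begin
  (c * f 0 + g 0) + sum (applyUpTo (λ j → c * f (suc j) + g (suc j)) M)
    ≡⟨ cong ((c * f 0 + g 0) +_) (sum-applyUpTo-linear c (f ∘ suc) (g ∘ suc) M) ⟩
  (c * f 0 + g 0) + (c * sum (applyUpTo (f ∘ suc) M) + sum (applyUpTo (g ∘ suc) M))
    ≡⟨ interchange (c * f 0) (g 0) _ _ ⟩
  (c * f 0 + c * sum (applyUpTo (f ∘ suc) M)) + (g 0 + sum (applyUpTo (g ∘ suc) M))
    ≡⟨ cong (_+ (g 0 + sum (applyUpTo (g ∘ suc) M))) (*-distribˡ-+ c (f 0) _) ⟨
  c * sum (applyUpTo f (suc M)) + sum (applyUpTo g (suc M)) ∎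
  where open ≡-Reasoning

sum-applyUpTo-< : ∀ {a} M → a ≤ M → sum (applyUpTo (λ j → fromBool (j <ᵇ a)) M) ≡ a
sum-applyUpTo-< {zero}  zero    _         = refl
sum-applyUpTo-< {zero}  (suc M) _         = sum-applyUpTo-< M z≤n
sum-applyUpTo-< {suc a} (suc M) (s≤s a≤M) = cong suc (sum-applyUpTo-< M a≤M)

sum-map-mono : ∀ {A : Set} {f g : A → ℕ} {xs} → All (λ x → f x ≤ g x) xs → sum (map f xs) ≤ sum (map g xs)
sum-map-mono []          = z≤n
sum-map-mono (fx≤gx ∷ ≤s) = +-mono-≤ fx≤gx (sum-map-mono ≤s)

equal-sums : ∀ {A : Set} (f g : A → ℕ) {xs} → All (λ x → f x ≤ g x) xs →
             sum (map g xs) ≤ sum (map f xs) → All (λ x → f x ≡ g x) xs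
equal-sums f g []                       _     = []
equal-sums f g {x ∷ xs} (fx≤gx ∷ ≤s) Σg≤Σf =
  ≤-antisym fx≤gx gx≤fx ∷ equal-sums f g ≤s G≤F
  where
  F G : ℕ
  F = sum (map f xs)
  G = sum (map g xs)
  G≤F : G ≤ F
  G≤F = +-cancelˡ-≤ (g x) G F (≤-trans Σg≤Σf (+-monoˡ-≤ F fx≤gx))
  gx≤fx : g x ≤ f x
  gx≤fx = +-cancelʳ-≤ F (g x) (f x) (≤-trans (+-monoʳ-≤ (g x) (sum-map-mono ≤s)) Σg≤Σf)

∑-mono : ∀ {m} {f g : Fin m → ℕ} → (∀ i → f i ≤ g i) → ∑[ i < m ] f i ≤ ∑[ i < m ] g i
∑-mono {zero}  f≤g = z≤n
∑-mono {suc m} f≤g = +-mono-≤ (f≤g fzero) (∑-mono (f≤g ∘ fsuc))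

∑-zero : ∀ {m} {f : Fin m → ℕ} → (∀ i → f i ≡ 0) → ∑[ i < m ] f i ≡ 0
∑-zero {m} f≡0 = trans (sum-cong-≗ f≡0) (sum-replicate-zero m)

∑-δ : ∀ {m} (f : Fin m → ℕ) j → ∑[ i < m ] (f i * fromBool (does (i ≟F j))) ≡ f j
∑-δ {suc m} f fzero    = trans (cong₂ _+_ (*-identityʳ (f fzero)) (∑-zero (λ i → *-zeroʳ (f (fsuc i))))) (+-identityʳ _)
∑-δ {suc m} f (fsuc j) = trans (cong₂ _+_ (*-zeroʳ (f fzero)) (sum-cong-≗ shift)) (∑-δ (f ∘ fsuc) j)
  where
  shift : ∀ i → f (fsuc i) * fromBool (does (fsuc i ≟F fsuc j)) ≡ f (fsuc i) * fromBool (does (i ≟F j))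
  shift i with i ≟F j
  ... | yes refl = refl
  ... | no _     = refl

Decreasing : List ℕ → Set
Decreasing = Linked _≥_

partition⇒decreasing : ∀ {m} (l : Vec ℕ m) → IsPartition l → Decreasing (Vec.toList l)
partition⇒decreasing []          _ = []
partition⇒decreasing (a ∷ [])     _ = [-]
partition⇒decreasing (a ∷ b ∷ l) P =
  P fzero (fsuc fzero) z≤n ∷ partition⇒decreasing (b ∷ l) (λ i j i≤j → P (fsuc i) (fsuc j) (s≤s i≤j))

decreasing⇒head≥ : ∀ {a l} → Decreasing (a ∷ l) → All (_≤ a) l
decreasing⇒head≥ [-]       = []
decreasing⇒head≥ {a} (b≤a ∷ b∷l↘) = Linked.Linked⇒All (λ y≤x z≤y → ≤-trans z≤y y≤x) {a} b≤a b∷l↘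

module _ {A : Set} {R : A → A → Set} where

  linked-reverse : ∀ {xs} → Linked (λ a b → R b a) xs → Linked R (reverse xs)
  linked-reverse []               = []
  linked-reverse {x ∷ xs} x↘xs = go [] xs [-] x↘xs
    where
    go : ∀ {y} acc ys → Linked R (y ∷ acc) → Linked (λ a b → R b a) (y ∷ ys) → Linked R (reverseAcc (y ∷ acc) ys)
    go acc []       l _        = l
    go acc (z ∷ zs) l (r ∷ l') = go (_ ∷ acc) zs (r ∷ l) l'

  linked-++ : ∀ {xs ys} → Linked R xs → Linked R ys → All (λ x → All (R x) ys) xs → Linked R (xs ++ ys)
  linked-++ []        ys↗ _                   = ys↗
  linked-++ {ys = []} [-] _ _                = [-]
  linked-++ {ys = _ ∷ _} [-] ys↗ ((r ∷ _) ∷ _) = r ∷ ys↗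
  linked-++ (r ∷ xs↗) ys↗ (_ ∷ rs)           = r ∷ linked-++ xs↗ ys↗ rs

  linked-tabulate : ∀ {m} (f : Fin m → A) → (∀ i j → toℕ i < toℕ j → R (f i) (f j)) → Linked R (tabulate f)
  linked-tabulate {zero}        f h = []
  linked-tabulate {suc zero}    f h = [-]
  linked-tabulate {suc (suc m)} f h =
    h fzero (fsuc fzero) (s≤s z≤n) ∷ linked-tabulate (f ∘ fsuc) (λ i j i<j → h (fsuc i) (fsuc j) (s≤s i<j))

module _ {n : ℕ} where

  infix 4 _∈ᶜ_

  _∈ᶜ_ : Letter n → Column n → Set
  x ∈ᶜ C = x ∈ᵇ C ≡ true

  ==L-refl : (x : Letter n) → (x ==L x) ≡ true
  ==L-refl (pos i) = dec-true (i ≟F i) refl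
  ==L-refl (neg i) = dec-true (i ≟F i) refl

  ==L⇒≡ : ∀ (x y : Letter n) → (x ==L y) ≡ true → x ≡ y
  ==L⇒≡ (pos i) (pos j) e with i ≟F j
  ... | yes refl = refl
  ==L⇒≡ (neg i) (neg j) e with i ≟F j
  ... | yes refl = refl

  ∈ᶜ-here : ∀ x (C : Column n) → x ∈ᶜ x ∷ C
  ∈ᶜ-here x C rewrite ==L-refl x = refl

  ∈ᶜ-there : ∀ {x} y {C : Column n} → x ∈ᶜ C → x ∈ᶜ y ∷ C
  ∈ᶜ-there {x} y x∈C rewrite x∈C = ∨-zeroʳ (x ==L y)

  ∈ᶜ-∷⁻ : ∀ {x y} {C : Column n} → x ∈ᶜ y ∷ C → x ≡ y ⊎ x ∈ᶜ C
  ∈ᶜ-∷⁻ {x} {y} x∈ with x ==L y in e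
  ... | true  = inj₁ (==L⇒≡ x y e)
  ... | false = inj₂ x∈

  ∈⇒∈ᶜ : ∀ {x} {C : Column n} → x ∈ C → x ∈ᶜ C
  ∈⇒∈ᶜ {C = y ∷ C} (here refl) = ∈ᶜ-here y C
  ∈⇒∈ᶜ {x} {y ∷ C} (there x∈) = ∈ᶜ-there {x} y {C} (∈⇒∈ᶜ x∈)

  ∈ᶜ⇒∈ : ∀ {x} {C : Column n} → x ∈ᶜ C → x ∈ C
  ∈ᶜ⇒∈ {x} {y ∷ C} x∈ with ∈ᶜ-∷⁻ {x} {y} {C} x∈
  ... | inj₁ refl = here refl
  ... | inj₂ x∈C  = there (∈ᶜ⇒∈ x∈C)

  ⊆ᶜ-intro : ∀ {C D : Column n} → (∀ x → x ∈ᶜ D → x ∈ᶜ C) → D ⊆ᶜ C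
  ⊆ᶜ-intro {C} {D} D⊆C = All.tabulate (λ {x} x∈D → D⊆C x (∈⇒∈ᶜ {C = D} x∈D))

  ∈ᶜ-allLetters : ∀ x → x ∈ᶜ allLetters n
  ∈ᶜ-allLetters (pos i) = ∈⇒∈ᶜ {C = allLetters n} (∈-++⁺ˡ (∈-map⁺ pos (∈-allFin i)))
  ∈ᶜ-allLetters (neg i) = ∈⇒∈ᶜ {C = allLetters n} (∈-++⁺ʳ _ (∈-map⁺ neg (reverse⁺ (∈-allFin i))))

  ∈ᶜ⇒nonEmpty : ∀ {x} (C : Column n) → x ∈ᶜ C → NonEmpty C
  ∈ᶜ⇒nonEmpty (_ ∷ _) _ = tt

  nonEmpty⇒∈ᶜ : ∀ {C : Column n} → NonEmpty C → ∃ λ x → x ∈ᶜ C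
  nonEmpty⇒∈ᶜ {x ∷ C} _ = x , ∈ᶜ-here x C

  ∈ᵇ-filterᵇ : ∀ (p : Letter n → Bool) x L → x ∈ᵇ filterᵇ p L ≡ (p x ∧ x ∈ᵇ L)
  ∈ᵇ-filterᵇ p x [] = sym (∧-zeroʳ (p x))
  ∈ᵇ-filterᵇ p x (y ∷ L) with p y in py
  ... | true with x ==L y in x=y
  ...   | false = ∈ᵇ-filterᵇ p x L
  ...   | true with refl ← ==L⇒≡ x y x=y = cong (_∧ true) (sym py)
  ∈ᵇ-filterᵇ p x (y ∷ L) | false with x ==L y in x=y
  ...   | false = ∈ᵇ-filterᵇ p x L
  ...   | true with refl ← ==L⇒≡ x y x=y =
    trans (∈ᵇ-filterᵇ p x L) (trans (cong (_∧ x ∈ᵇ L) py) (cong (_∧ true) (sym py)))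

  ∈ᵇ-filterᵇ-allLetters : ∀ (p : Letter n → Bool) x → x ∈ᵇ filterᵇ p (allLetters n) ≡ p x
  ∈ᵇ-filterᵇ-allLetters p x = trans (∈ᵇ-filterᵇ p x (allLetters n)) (trans (cong (p x ∧_) (∈ᶜ-allLetters x)) (∧-identityʳ (p x)))

  Sorted : Column n → Set
  Sorted = Linked _<L_

  <L-trans : ∀ {x y z : Letter n} → x <L y → y <L z → x <L z
  <L-trans {x} {y} {z} = <-trans {rank x} {rank y} {rank z}

  sorted⇒head< : ∀ {y} {C : Column n} → Sorted (y ∷ C) → All (y <L_) C
  sorted⇒head< [-]           = []
  sorted⇒head< {y} (r ∷ y↗C) = Linked.Linked⇒All (λ {a} {b} {c} → <L-trans {a} {b} {c}) {y} r y↗C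

  sorted⇒head≤ : ∀ {x y} {C : Column n} → Sorted (y ∷ C) → x ∈ᶜ y ∷ C → y ≤L x
  sorted⇒head≤ {x} {y} {C} y↗C x∈ with ∈ᶜ-∷⁻ {x} {y} {C} x∈
  ... | inj₁ refl = ≤-refl
  ... | inj₂ x∈C  = <⇒≤ (All.lookup (sorted⇒head< y↗C) (∈ᶜ⇒∈ {x} {C} x∈C))

  sorted⇒head∉tail : ∀ {y} {C : Column n} → Sorted (y ∷ C) → y ∈ᵇ C ≡ false
  sorted⇒head∉tail {y} {C} y↗C = ¬-not (λ y∈C → <-irrefl refl (All.lookup (sorted⇒head< y↗C) (∈ᶜ⇒∈ {y} {C} y∈C)))

  sorted-allLetters : Sorted (allLetters n)
  sorted-allLetters = linked-++ positives negatives
    (All.map⁺ (All.universal (λ i → All.map⁺ (All.universal (λ j → ≤-trans (toℕ<n i) (m≤m+n n _)) _)) _))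
    where
    positives : Sorted (map pos (allFin n))
    positives = Linked.map⁺ (linked-tabulate (λ i → i) (λ i j i<j → i<j))
    negatives : Sorted (map neg (reverse (allFin n)))
    negatives = Linked.map⁺ (linked-reverse (linked-tabulate (λ i → i)
      (λ i j i<j → +-monoʳ-< n (∸-monoʳ-< (s≤s i<j) (toℕ<n j)))))

  rank-injective : ∀ (x y : Letter n) → rank x ≡ rank y → x ≡ y
  rank-injective (pos i) (pos j) e = cong pos (toℕ-injective e)
  rank-injective (neg i) (neg j) e =
    cong neg (toℕ-injective (suc-injective (∸-cancelˡ-≡ (toℕ<n i) (toℕ<n j) (+-cancelˡ-≡ n _ _ e))))
  rank-injective (pos i) (neg j) e = ⊥-elim (<⇒≱ (toℕ<n i) (≤-trans (m≤m+n n _) (≤-reflexive (sym e))))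
  rank-injective (neg i) (pos j) e = ⊥-elim (<⇒≱ (toℕ<n j) (≤-trans (m≤m+n n _) (≤-reflexive e)))

  sorted-≡ : ∀ {C D : Column n} → Sorted C → Sorted D → (∀ x → x ∈ᵇ C ≡ x ∈ᵇ D) → C ≡ D
  sorted-≡ {[]}    {[]}    _   _   _   = refl
  sorted-≡ {[]}    {y ∷ D} _   _   C≐D = contradiction (trans (C≐D y) (∈ᶜ-here y D)) λ ()
  sorted-≡ {x ∷ C} {[]}    _   _   C≐D = contradiction (trans (sym (C≐D x)) (∈ᶜ-here x C)) λ ()
  sorted-≡ {x ∷ C} {y ∷ D} x↗C y↗D C≐D
    with refl ← rank-injective x y (≤-antisym (sorted⇒head≤ {y} {x} {C} x↗C (trans (C≐D y) (∈ᶜ-here y D)))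
                                             (sorted⇒head≤ {x} {y} {D} y↗D (trans (sym (C≐D x)) (∈ᶜ-here x C))))
    = cong (x ∷_) (sorted-≡ (Linked.tail x↗C) (Linked.tail y↗D) tails)
    where
    tails : ∀ z → z ∈ᵇ C ≡ z ∈ᵇ D
    tails z with z ==L x in z=x | C≐D z
    ... | false | C≐Dz = C≐Dz
    ... | true  | _ with refl ← ==L⇒≡ z x z=x = trans (sorted⇒head∉tail x↗C) (sym (sorted⇒head∉tail y↗D))

  ⊆ᶜ⇒RowLeq : ∀ {C D : Column n} → Sorted C → Sorted D → D ⊆ᶜ C → RowLeq C D
  ⊆ᶜ⇒RowLeq {C}     {[]}    _   _   _            = tt
  ⊆ᶜ⇒RowLeq {[]}    {d ∷ D} _   _   (() ∷ _)
  ⊆ᶜ⇒RowLeq {c ∷ C} {d ∷ D} c↗C d↗D (d∈ ∷ D⊆) =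
    c≤d , ⊆ᶜ⇒RowLeq (Linked.tail c↗C) (Linked.tail d↗D) (All.zipWith (λ {z} → D⊆C {z}) (sorted⇒head< d↗D , D⊆))
    where
    c≤d : c ≤L d
    c≤d = sorted⇒head≤ {d} {c} {C} c↗C d∈
    D⊆C : ∀ {z} → d <L z × z ∈ᶜ c ∷ C → z ∈ᶜ C
    D⊆C {z} (d<z , z∈) with ∈ᶜ-∷⁻ {z} {c} {C} z∈
    ... | inj₁ refl = contradiction c≤d (<⇒≱ d<z)
    ... | inj₂ z∈C  = z∈C

  sorted-filterᵇ : ∀ (p : Letter n → Bool) {L} → Sorted L → Sorted (filterᵇ p L)
  sorted-filterᵇ p = Linked.filter⁺ (T? ∘ p) (λ {a} {b} {c} → <L-trans {a} {b} {c})

  reorder-sorted : ∀ {C : Column n} → Sorted C → reorder C ≡ C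
  reorder-sorted {C} C↗ = sorted-≡ (sorted-filterᵇ (_∈ᵇ C) sorted-allLetters) C↗ (∈ᵇ-filterᵇ-allLetters (_∈ᵇ C))

  filter-==L-∉ : ∀ x (L : Column n) → x ∈ᵇ L ≡ false → filterᵇ (x ==L_) L ≡ []
  filter-==L-∉ x []      _  = refl
  filter-==L-∉ x (y ∷ L) x∉ with x ==L y | x∉
  ... | false | x∉L = filter-==L-∉ x L x∉L

  filter-==L-∈ : ∀ x (L : Column n) → x ∈ᶜ L → 0 < length (filterᵇ (x ==L_) L)
  filter-==L-∈ x (y ∷ L) x∈ with x ==L y | x∈
  ... | true  | _   = s≤s z≤n
  ... | false | x∈L = filter-==L-∈ x L x∈L

  length-filter-sorted : ∀ x {C : Column n} → Sorted C → length (filterᵇ (x ==L_) C) ≡ fromBool (x ∈ᵇ C)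
  length-filter-sorted x {[]}    _   = refl
  length-filter-sorted x {y ∷ C} y↗C with x ==L y in x=y
  ... | false = length-filter-sorted x (Linked.tail y↗C)
  ... | true with refl ← ==L⇒≡ x y x=y = cong (suc ∘ length) (filter-==L-∉ x C (sorted⇒head∉tail y↗C))

  count-∷ : ∀ x {C : Column n} T → Sorted C → count x (C ∷ T) ≡ fromBool (x ∈ᵇ C) + count x T
  count-∷ x {C} T C↗ = begin
    length (filterᵇ (x ==L_) (C ++ concat T))
      ≡⟨ cong length (filter-++ (T? ∘ (x ==L_)) C (concat T)) ⟩
    length (filterᵇ (x ==L_) C ++ filterᵇ (x ==L_) (concat T))
      ≡⟨ length-++ (filterᵇ (x ==L_) C) ⟩
    length (filterᵇ (x ==L_) C) + count x T
      ≡⟨ cong (_+ count x T) (length-filter-sorted x C↗) ⟩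
    fromBool (x ∈ᵇ C) + count x T ∎
    where open ≡-Reasoning

  ∉⇒count≡0 : ∀ x (T : Tableau n) → x ∈ᵇ concat T ≡ false → count x T ≡ 0
  ∉⇒count≡0 x T x∉ = cong length (filter-==L-∉ x (concat T) x∉)

  ∈ᶜ⇒count>0 : ∀ x (T : Tableau n) → x ∈ᶜ concat T → 0 < count x T
  ∈ᶜ⇒count>0 x T = filter-==L-∈ x (concat T)

  count-≤-length : ∀ x {T : Tableau n} → All Sorted T → count x T ≤ length T
  count-≤-length x {[]}    []        = z≤n
  count-≤-length x {C ∷ T} (C↗ ∷ T↗) rewrite count-∷ x T C↗ =
    +-mono-≤ (fromBool≤1 (x ∈ᵇ C)) (count-≤-length x T↗)
    where
    fromBool≤1 : ∀ b → fromBool b ≤ 1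
    fromBool≤1 true  = ≤-refl
    fromBool≤1 false = z≤n

  -- Columns without a pair i, ī

  Unpaired : Column n → Set
  Unpaired C = (i : Fin n) → ¬ (pos i ∈ᶜ C × neg i ∈ᶜ C)

  unpaired-⊆ : ∀ {C D : Column n} → (∀ x → x ∈ᶜ D → x ∈ᶜ C) → Unpaired C → Unpaired D
  unpaired-⊆ D⊆C u i (p , q) = u i (D⊆C (pos i) p , D⊆C (neg i) q)

  unpaired⇒admissible : ∀ {C : Column n} → Unpaired C → Admissible C
  unpaired⇒admissible {C} u p q i p≡i q≡ī =
    ⊥-elim (u i (∈⇒∈ᶜ {C = C} (subst (_∈ C) p≡i (∈-lookup p)) , ∈⇒∈ᶜ {C = C} (subst (_∈ C) q≡ī (∈-lookup q))))

  zs-unpaired : ∀ {C : Column n} → Unpaired C → zs C ≡ []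
  zs-unpaired {C} u = cong reverse (filter-none (T? ∘ _) (All.universal noPair (allFin n)))
    where
    noPair : ∀ z → ¬ T (pos z ∈ᵇ C ∧ neg z ∈ᵇ C)
    noPair z t with Equivalence.to T-∧ t
    ... | tp , tn = u z (Equivalence.to T-≡ tp , Equivalence.to T-≡ tn)

  ts-unpaired : ∀ {C : Column n} → Unpaired C → ts C ≡ just []
  ts-unpaired {C} u = cong (tsFrom C n) (zs-unpaired {C} u)

  assoc-[] : ∀ (zs : List (Fin n)) x → assoc zs [] x ≡ x
  assoc-[] []      x = refl
  assoc-[] (_ ∷ _) x = refl

  lCol-unpaired : ∀ {C : Column n} → Unpaired C → Sorted C → lCol C ≡ just C
  lCol-unpaired {C} u C↗ with ts C | ts-unpaired {C} u
  ... | _ | refl = cong just (trans (cong reorder (map-id-local (All.universal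
    (λ { (pos i) → cong pos (assoc-[] (zs C) i) ; (neg i) → refl }) C))) (reorder-sorted C↗))

  rCol-unpaired : ∀ {C : Column n} → Unpaired C → Sorted C → rCol C ≡ just C
  rCol-unpaired {C} u C↗ with ts C | ts-unpaired {C} u
  ... | _ | refl = cong just (trans (cong reorder (map-id-local (All.universal
    (λ { (pos i) → refl ; (neg i) → cong neg (assoc-[] (zs C) i) }) C))) (reorder-sorted C↗))

  doubled : Tableau n → Tableau n
  doubled []      = []
  doubled (C ∷ T) = C ∷ C ∷ doubled T

  splitTableau-unpaired : ∀ {T : Tableau n} → All Unpaired T → All Sorted T → splitTableau T ≡ just (doubled T)
  splitTableau-unpaired {[]}    _        _          = refl
  splitTableau-unpaired {C ∷ T} (u ∷ us) (C↗ ∷ T↗)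
    rewrite lCol-unpaired {C} u C↗ | rCol-unpaired {C} u C↗ | splitTableau-unpaired us T↗ = refl

  rowLeq-refl : ∀ (C : Column n) → RowLeq C C
  rowLeq-refl []      = tt
  rowLeq-refl (c ∷ C) = ≤-refl , rowLeq-refl C

  semistandard-doubled : ∀ {T : Tableau n} → Semistandard T → Semistandard (doubled T)
  semistandard-doubled (ne , T↗ , rows) = all-doubled ne , all-doubled T↗ , rows-doubled rows
    where
    all-doubled : ∀ {P : Column n → Set} {T} → All P T → All P (doubled T)
    all-doubled []       = []
    all-doubled (p ∷ ps) = p ∷ p ∷ all-doubled ps
    rows-doubled : ∀ {T} → Linked RowLeq T → Linked RowLeq (doubled T)
    rows-doubled []                = []
    rows-doubled {C ∷ _} [-]       = rowLeq-refl C ∷ [-]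
    rows-doubled {C ∷ _} (r ∷ rs)  = rowLeq-refl C ∷ r ∷ rows-doubled rs

  unpaired⇒IsKN : ∀ {T : Tableau n} → Semistandard T → All Unpaired T → IsKN T
  unpaired⇒IsKN ss@(_ , T↗ , _) us =
    ss , All.map (λ {C} → unpaired⇒admissible {C}) us , _ , splitTableau-unpaired us T↗ , semistandard-doubled ss

  nested-unpaired⇒IsKey : ∀ {T : Tableau n} → Semistandard T → ColsNested T → Unpaired (concat T) → IsKey T
  nested-unpaired⇒IsKey {T} ss nested u = unpaired⇒IsKN ss (All.tabulate columnUnpaired) , nested , u
    where
    columnUnpaired : ∀ {C} → C ∈ T → Unpaired C
    columnUnpaired {C} C∈T =
      unpaired-⊆ {concat T} {C} (λ x x∈C → ∈⇒∈ᶜ {C = concat T} (∈-concat⁺′ (∈ᶜ⇒∈ {x} {C} x∈C) C∈T)) u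

  -- The key tableau of a content

  keyColumn : (Letter n → ℕ) → ℕ → Column n
  keyColumn c j = filterᵇ (λ x → j <ᵇ c x) (allLetters n)

  keyTableau : (Letter n → ℕ) → ℕ → Tableau n
  keyTableau c k = applyUpTo (keyColumn c) k

  ∈ᵇ-keyColumn : ∀ c j x → x ∈ᵇ keyColumn c j ≡ (j <ᵇ c x)
  ∈ᵇ-keyColumn c j = ∈ᵇ-filterᵇ-allLetters (λ x → j <ᵇ c x)

  sorted-keyColumn : ∀ c j → Sorted (keyColumn c j)
  sorted-keyColumn c j = sorted-filterᵇ _ sorted-allLetters

  keyColumn-suc : ∀ c j → keyColumn c (suc j) ≡ keyColumn (pred ∘ c) j
  keyColumn-suc c j = filterᵇ-cong (λ x → suc<ᵇ (c x)) (allLetters n)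
    where
    suc<ᵇ : ∀ m → (suc j <ᵇ m) ≡ (j <ᵇ pred m)
    suc<ᵇ zero    = refl
    suc<ᵇ (suc m) = refl

  keyColumn-nested : ∀ c j → keyColumn c (suc j) ⊆ᶜ keyColumn c j
  keyColumn-nested c j = ⊆ᶜ-intro {keyColumn c j} {keyColumn c (suc j)} λ x x∈ →
    trans (∈ᵇ-keyColumn c j x) (<⇒<ᵇ≡true (<-trans (n<1+n j) (<ᵇ≡true⇒< {suc j} {c x} (trans (sym (∈ᵇ-keyColumn c (suc j) x)) x∈))))

  count-keyTableau : ∀ c k x → count x (keyTableau c k) ≡ c x ⊓ k
  count-keyTableau c zero    x = sym (⊓-zeroʳ (c x))
  count-keyTableau c (suc k) x = begin
    count x (keyColumn c 0 ∷ applyUpTo (keyColumn c ∘ suc) k)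
      ≡⟨ count-∷ x (applyUpTo (keyColumn c ∘ suc) k) (sorted-keyColumn c 0) ⟩
    fromBool (x ∈ᵇ keyColumn c 0) + count x (applyUpTo (keyColumn c ∘ suc) k)
      ≡⟨ cong₂ _+_ (cong fromBool (∈ᵇ-keyColumn c 0 x)) (cong (count x) (applyUpTo-cong (keyColumn-suc c) k)) ⟩
    fromBool (0 <ᵇ c x) + count x (keyTableau (pred ∘ c) k)
      ≡⟨ cong (fromBool (0 <ᵇ c x) +_) (count-keyTableau (pred ∘ c) k x) ⟩
    fromBool (0 <ᵇ c x) + pred (c x) ⊓ k
      ≡⟨ peel (c x) ⟩
    c x ⊓ suc k ∎
    where
    open ≡-Reasoning
    peel : ∀ m → fromBool (0 <ᵇ m) + pred m ⊓ k ≡ m ⊓ suc k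
    peel zero    = refl
    peel (suc m) = refl

  keyTableau-isKey : ∀ c k → (∀ {j} → j < k → ∃ λ x → j < c x) →
                     (∀ i → c (pos i) ≡ 0 ⊎ c (neg i) ≡ 0) → IsKey (keyTableau c k)
  keyTableau-isKey c k occupied unpaired =
    nested-unpaired⇒IsKey (nonEmpty , sorted , rows) nested noPair
    where
    nonEmpty : All NonEmpty (keyTableau c k)
    nonEmpty = All.applyUpTo⁺₁ (keyColumn c) k λ {j} j<k →
      ∈ᶜ⇒nonEmpty {proj₁ (occupied j<k)} (keyColumn c j) (trans (∈ᵇ-keyColumn c j _) (<⇒<ᵇ≡true (proj₂ (occupied j<k))))
    sorted : All Sorted (keyTableau c k)
    sorted = All.applyUpTo⁺₂ (keyColumn c) k (sorted-keyColumn c)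
    rows : Linked RowLeq (keyTableau c k)
    rows = Linked.applyUpTo⁺₂ (keyColumn c) k λ j →
      ⊆ᶜ⇒RowLeq (sorted-keyColumn c j) (sorted-keyColumn c (suc j)) (keyColumn-nested c j)
    nested : ColsNested (keyTableau c k)
    nested = Linked.applyUpTo⁺₂ (keyColumn c) k (keyColumn-nested c)
    absent : ∀ x → c x ≡ 0 → ¬ x ∈ᶜ concat (keyTableau c k)
    absent x cx≡0 x∈ = <-irrefl (sym (trans (count-keyTableau c k x) (cong (_⊓ k) cx≡0)))
                                (∈ᶜ⇒count>0 x (keyTableau c k) x∈)
    noPair : Unpaired (concat (keyTableau c k))
    noPair i (p , q) with unpaired i
    ... | inj₁ c[i]≡0 = absent (pos i) c[i]≡0 p
    ... | inj₂ c[ī]≡0 = absent (neg i) c[ī]≡0 q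

  count-tail-∉ : ∀ x {C} {T : Tableau n} → All Sorted (C ∷ T) → ColsNested (C ∷ T) →
                 x ∈ᵇ C ≡ false → count x T ≡ 0
  count-tail-∉ x {C} {[]}    _                _              _   = refl
  count-tail-∉ x {C} {D ∷ T} (_ ∷ D↗ ∷ T↗) (D⊆C ∷ nested) x∉C =
    trans (count-∷ x T D↗) (cong₂ _+_ (cong fromBool x∉D) (count-tail-∉ x (D↗ ∷ T↗) nested x∉D))
    where
    x∉D : x ∈ᵇ D ≡ false
    x∉D = ¬-not λ x∈D → case trans (sym (All.lookup D⊆C (∈ᶜ⇒∈ {x} {D} x∈D))) x∉C of λ ()

  nested⇒keyTableau : ∀ {T : Tableau n} → All Sorted T → ColsNested T →
                      T ≡ keyTableau (λ x → count x T) (length T)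
  nested⇒keyTableau {[]}    _             _      = refl
  nested⇒keyTableau {C ∷ T} C∷T↗@(C↗ ∷ T↗) nested =
    cong₂ _∷_ (sorted-≡ C↗ (sorted-keyColumn c 0) (λ x → trans (firstColumn x) (sym (∈ᵇ-keyColumn c 0 x))))
              (trans (nested⇒keyTableau T↗ (Linked.tail nested))
                     (applyUpTo-cong (λ j → filterᵇ-cong (laterColumns j) (allLetters n)) (length T)))
    where
    c : Letter n → ℕ
    c x = count x (C ∷ T)
    firstColumn : ∀ x → x ∈ᵇ C ≡ (0 <ᵇ c x)
    firstColumn x with x ∈ᵇ C in x∈C
    ... | true  rewrite count-∷ x T C↗ | x∈C = refl
    ... | false rewrite count-∷ x T C↗ | x∈C | count-tail-∉ x C∷T↗ nested x∈C = refl
    laterColumns : ∀ j x → (j <ᵇ count x T) ≡ (suc j <ᵇ c x)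
    laterColumns j x with x ∈ᵇ C in x∈C
    ... | true  rewrite count-∷ x T C↗ | x∈C = refl
    ... | false rewrite count-∷ x T C↗ | x∈C | count-tail-∉ x C∷T↗ nested x∈C = refl

  keyTableau-unique : ∀ c k → (∀ {j} → j < k → ∃ λ x → j < c x) → (∀ x → c x ≤ k) →
                      ∀ {T : Tableau n} → All NonEmpty T → All Sorted T → ColsNested T →
                      (∀ x → count x T ≡ c x) → T ≡ keyTableau c k
  keyTableau-unique c k occupied bounded {T} ne T↗ nested count≡c = trans T≡ (cong (keyTableau c) length≡k)
    where
    T≡ : T ≡ keyTableau c (length T)
    T≡ = trans (nested⇒keyTableau T↗ nested)
               (applyUpTo-cong (λ j → filterᵇ-cong (λ x → cong (j <ᵇ_) (count≡c x)) (allLetters n)) (length T))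
    length≡k : length T ≡ k
    length≡k with <-cmp (length T) k
    ... | tri≈ _ T≡k _ = T≡k
    ... | tri< T<k _ _ =
      let (x , T<cx) = occupied T<k in
      contradiction (subst (_≤ length T) (count≡c x) (count-≤-length x T↗)) (<⇒≱ T<cx)
    ... | tri> _ _ k<T =
      let (x , x∈) = nonEmpty⇒∈ᶜ (All.applyUpTo⁻ (keyColumn c) (length T) (subst (All NonEmpty) T≡ ne) k<T) in
      contradiction (bounded x) (<⇒≱ (<ᵇ≡true⇒< {k} {c x} (trans (sym (∈ᵇ-keyColumn c k x)) x∈)))

posPart negPart : ℤ → ℕ
posPart (ofℕ k)    = k
posPart -[1+ k ] = 0
negPart (ofℕ k)    = 0
negPart -[1+ k ] = suc k

posPart-negPart : ∀ z → ofℕ (posPart z) -ℤ ofℕ (negPart z) ≡ z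
posPart-negPart (ofℕ k)    = ℤ.+-identityʳ (ofℕ k)
posPart-negPart -[1+ k ] = refl

parts-of-difference : ∀ a b → a ≡ 0 ⊎ b ≡ 0 → posPart (ofℕ a -ℤ ofℕ b) ≡ a × negPart (ofℕ a -ℤ ofℕ b) ≡ b
parts-of-difference a       b       (inj₂ refl) = +-identityʳ a , refl
parts-of-difference .0      zero    (inj₁ refl) = refl , refl
parts-of-difference .0      (suc b) (inj₁ refl) = refl , refl

difference-≤ : ∀ a b c → ofℕ a -ℤ ofℕ b ≡ ofℕ c → c ≤ a
difference-≤ a b c eq = ℤ.drop‿+≤+ (subst (_≤ℤ ofℕ a) (trans (sym (ℤ.m-n≡m⊖n a b)) eq) (ℤ.m⊖n≤m a b))

module _ {n : ℕ} where

  mult : Vec ℤ n → Letter n → ℕ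
  mult v (pos i) = posPart (Vec.lookup v i)
  mult v (neg i) = negPart (Vec.lookup v i)

  mult-unpaired : ∀ v i → mult v (pos i) ≡ 0 ⊎ mult v (neg i) ≡ 0
  mult-unpaired v i with Vec.lookup v i
  ... | ofℕ _    = inj₂ refl
  ... | -[1+ _ ] = inj₁ refl

  lookup-weight : ∀ (T : Tableau n) i → Vec.lookup (weight T) i ≡ ofℕ (count (pos i) T) -ℤ ofℕ (count (neg i) T)
  lookup-weight T i = Vec.lookup∘tabulate _ i

  weight-keyTableau : ∀ v k → (∀ x → mult v x ≤ k) → weight (keyTableau (mult v) k) ≡ v
  weight-keyTableau v k bounded = trans (Vec.tabulate-cong entry) (Vec.tabulate∘lookup v)
    where
    count≡mult : ∀ x → count x (keyTableau (mult v) k) ≡ mult v x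
    count≡mult x = trans (count-keyTableau (mult v) k x) (m≤n⇒m⊓n≡m (bounded x))
    entry : ∀ i → ofℕ (count (pos i) (keyTableau (mult v) k)) -ℤ ofℕ (count (neg i) (keyTableau (mult v) k)) ≡ Vec.lookup v i
    entry i = trans (cong₂ (λ a b → ofℕ a -ℤ ofℕ b) (count≡mult (pos i)) (count≡mult (neg i))) (posPart-negPart (Vec.lookup v i))

  unpaired-count : ∀ {T : Tableau n} → Unpaired (concat T) → ∀ i → count (pos i) T ≡ 0 ⊎ count (neg i) T ≡ 0
  unpaired-count {T} u i with pos i ∈ᵇ concat T in p | neg i ∈ᵇ concat T in q
  ... | false | _     = inj₁ (∉⇒count≡0 (pos i) T p)
  ... | true  | false = inj₂ (∉⇒count≡0 (neg i) T q)
  ... | true  | true  = ⊥-elim (u i (p , q))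

  count≡mult-weight : ∀ {T : Tableau n} → Unpaired (concat T) → ∀ x → count x T ≡ mult (weight T) x
  count≡mult-weight {T} u (pos i) =
    sym (trans (cong posPart (lookup-weight T i)) (proj₁ (parts-of-difference _ _ (unpaired-count {T} u i))))
  count≡mult-weight {T} u (neg i) =
    sym (trans (cong negPart (lookup-weight T i)) (proj₂ (parts-of-difference _ _ (unpaired-count {T} u i))))

  length-keyColumn-mult : ∀ (v : Vec ℤ n) j →
                          length (keyColumn (mult v) j) ≡ countᵇ (j <ᵇ_) (map ∣_∣ (Vec.toList v))
  length-keyColumn-mult v j = begin
    countᵇ P (map pos (allFin n) ++ map neg (reverse (allFin n)))
      ≡⟨ countᵇ-++ P (map pos (allFin n)) _ ⟩
    countᵇ P (map pos (allFin n)) + countᵇ P (map neg (reverse (allFin n)))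
      ≡⟨ cong₂ _+_ (countᵇ-map P pos (allFin n))
                   (trans (countᵇ-map P neg (reverse (allFin n))) (countᵇ-↭ (P ∘ neg) (↭.↭-reverse (allFin n)))) ⟩
    countᵇ (P ∘ pos) (allFin n) + countᵇ (P ∘ neg) (allFin n)
      ≡⟨ countᵇ-+ (λ i → split (Vec.lookup v i)) (allFin n) ⟩
    countᵇ ((j <ᵇ_) ∘ ∣_∣ ∘ Vec.lookup v) (allFin n)
      ≡⟨ countᵇ-map (j <ᵇ_) (∣_∣ ∘ Vec.lookup v) (allFin n) ⟨
    countᵇ (j <ᵇ_) (map (∣_∣ ∘ Vec.lookup v) (allFin n))
      ≡⟨ cong (countᵇ (j <ᵇ_)) (trans (map-∘ (allFin n)) (cong (map ∣_∣) (map-lookup-allFin v))) ⟩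
    countᵇ (j <ᵇ_) (map ∣_∣ (Vec.toList v)) ∎
    where
    open ≡-Reasoning
    P : Letter n → Bool
    P x = j <ᵇ mult v x
    split : ∀ z → fromBool (j <ᵇ posPart z) + fromBool (j <ᵇ negPart z) ≡ fromBool (j <ᵇ ∣ z ∣)
    split (ofℕ k)    = +-identityʳ _
    split -[1+ k ] = refl

-- The hyperoctahedral orbit

swapAt-↭ : ∀ {m} k (v : Vec ℤ m) → Vec.toList (swapAt k v) ↭ Vec.toList v
swapAt-↭ zero    []           = ↭-reflexive refl
swapAt-↭ zero    (x ∷ [])     = ↭-reflexive refl
swapAt-↭ zero    (x ∷ y ∷ v)  = ↭-swap y x (↭-reflexive refl)
swapAt-↭ (suc k) []           = ↭-reflexive refl
swapAt-↭ (suc k) (x ∷ v)      = prep x (swapAt-↭ k v)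

abs-negLast : ∀ {m} (v : Vec ℤ m) → map ∣_∣ (Vec.toList (negLast v)) ≡ map ∣_∣ (Vec.toList v)
abs-negLast []          = refl
abs-negLast (x ∷ [])    = cong (_∷ []) (ℤ.∣-i∣≡∣i∣ x)
abs-negLast (x ∷ y ∷ v) = cong (∣ x ∣ ∷_) (abs-negLast (y ∷ v))

abs-toℤ : ∀ {m} (l : Vec ℕ m) → map ∣_∣ (Vec.toList (toℤ l)) ≡ Vec.toList l
abs-toℤ []      = refl
abs-toℤ (x ∷ l) = cong (x ∷_) (abs-toℤ l)

orbit-abs-↭ : ∀ {m} {l : Vec ℕ m} {v} → InOrbit (toℤ l) v → map ∣_∣ (Vec.toList v) ↭ Vec.toList l
orbit-abs-↭ {l = l} here     = ↭-reflexive (abs-toℤ l)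
orbit-abs-↭ (swap k _ v∈)    = ↭-trans (↭.map⁺ ∣_∣ (swapAt-↭ k _)) (orbit-abs-↭ v∈)
orbit-abs-↭ (flip {v} v∈)    = ↭-trans (↭-reflexive (abs-negLast v)) (orbit-abs-↭ v∈)

largestPart : ∀ {m} → Vec ℕ m → ℕ
largestPart = Vec.foldr _ _⊔_ 0

countᵇ-<-largestPart : ∀ {m} (l : Vec ℕ m) {j} → j < largestPart l → 0 < countᵇ (j <ᵇ_) (Vec.toList l)
countᵇ-<-largestPart (x ∷ l) {j} j<λ₁ rewrite countᵇ-∷ (j <ᵇ_) x (Vec.toList l) with ⊔-sel x (largestPart l)
... | inj₁ x⊔w≡x rewrite <⇒<ᵇ≡true (subst (j <_) x⊔w≡x j<λ₁) = s≤s z≤n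
... | inj₂ x⊔w≡w = ≤-trans (countᵇ-<-largestPart l (subst (j <_) x⊔w≡w j<λ₁)) (m≤n+m _ _)

entries-≤-largestPart : ∀ {m} (l : Vec ℕ m) → All (_≤ largestPart l) (Vec.toList l)
entries-≤-largestPart []      = []
entries-≤-largestPart (x ∷ l) =
  m≤m⊔n x (largestPart l) ∷ All.map (λ y≤w → ≤-trans y≤w (m≤n⊔m x (largestPart l))) (entries-≤-largestPart l)

countᵇ-largestPart : ∀ {m} (l : Vec ℕ m) → countᵇ (largestPart l <ᵇ_) (Vec.toList l) ≡ 0
countᵇ-largestPart l = countᵇ-<-all≤ (entries-≤-largestPart l)

module _ {n : ℕ} (λ' : Vec ℕ n) {v : Vec ℤ n} (v∈ : InOrbit (toℤ λ') v) where

  length-keyColumn-orbit : ∀ j → length (keyColumn (mult v) j) ≡ countᵇ (j <ᵇ_) (Vec.toList λ')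
  length-keyColumn-orbit j = trans (length-keyColumn-mult v j) (countᵇ-↭ (j <ᵇ_) (orbit-abs-↭ v∈))

  orbit-occupied : ∀ {j} → j < largestPart λ' → ∃ λ x → j < mult v x
  orbit-occupied {j} j<λ₁ =
    let (x , x∈) = nonEmpty⇒∈ᶜ (nonEmpty (keyColumn (mult v) j)
                     (subst (0 <_) (sym (length-keyColumn-orbit j)) (countᵇ-<-largestPart λ' j<λ₁)))
    in x , <ᵇ≡true⇒< {j} {mult v x} (trans (sym (∈ᵇ-keyColumn (mult v) j x)) x∈)
    where
    nonEmpty : ∀ (C : Column n) → 0 < length C → NonEmpty C
    nonEmpty (_ ∷ _) _ = tt

  orbit-bounded : ∀ x → mult v x ≤ largestPart λ'
  orbit-bounded x = ≮⇒≥ λ λ₁<x →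
    empty (keyColumn (mult v) (largestPart λ')) (trans (length-keyColumn-orbit (largestPart λ')) (countᵇ-largestPart λ'))
          (trans (∈ᵇ-keyColumn (mult v) (largestPart λ') x) (<⇒<ᵇ≡true λ₁<x))
    where
    empty : ∀ (C : Column n) → length C ≡ 0 → ¬ x ∈ᶜ C
    empty [] _ ()

  keyTableau-shape : HasShape (keyTableau (mult v) (largestPart λ')) λ'
  keyTableau-shape = begin
    map length (applyUpTo (keyColumn (mult v)) (largestPart λ'))
      ≡⟨ map-applyUpTo (keyColumn (mult v)) length (largestPart λ') ⟩
    applyUpTo (length ∘ keyColumn (mult v)) (largestPart λ')
      ≡⟨ applyUpTo-cong length-keyColumn-orbit (largestPart λ') ⟩
    applyUpTo (λ j → countᵇ (j <ᵇ_) (Vec.toList λ')) (largestPart λ')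
      ≡⟨ map-applyUpTo (λ j → j) (λ j → countᵇ (j <ᵇ_) (Vec.toList λ')) (largestPart λ') ⟨
    conjugate λ' ∎
    where open ≡-Reasoning

  unique-key-in-orbit : Σ (Tableau n) λ K → IsKey K × weight K ≡ v × HasShape K λ' ×
                          ((K' : Tableau n) → IsKey K' → weight K' ≡ v → K' ≡ K)
  unique-key-in-orbit =
    K , keyTableau-isKey (mult v) (largestPart λ') orbit-occupied (mult-unpaired v) ,
    weight-keyTableau v (largestPart λ') orbit-bounded , keyTableau-shape , unique
    where
    K : Tableau n
    K = keyTableau (mult v) (largestPart λ')
    unique : (K' : Tableau n) → IsKey K' → weight K' ≡ v → K' ≡ K
    unique K' (((ne , K'↗ , _) , _) , nested , u) w≡v =
      keyTableau-unique (mult v) (largestPart λ') orbit-occupied orbit-bounded ne K'↗ nested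
        (λ x → trans (count≡mult-weight {T = K'} u x) (cong (λ w → mult w x) w≡v))

-- Scores

module _ {n : ℕ} where

  -- The unbarred letter of 0-based index i scores n − i; barred letters score 0 by truncation.
  score : Letter n → ℕ
  score x = n ∸ rank x

  columnScore : Column n → ℕ
  columnScore C = sum (map score C)

  maxScore : ℕ → ℕ → ℕ
  maxScore o zero    = 0
  maxScore o (suc m) = (n ∸ o) + maxScore (suc o) m

  Initial : ℕ → Column n → Set
  Initial o []      = ⊤
  Initial o (x ∷ C) = rank x ≡ o × Initial (suc o) C

  ranks-above : ∀ o {x} {C : Column n} → o ≤ rank x → Sorted (x ∷ C) → All (λ y → suc o ≤ rank y) C
  ranks-above o {x} o≤x x↗C = All.map (λ {y} x<y → ≤-<-trans o≤x x<y) (sorted⇒head< x↗C)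

  columnScore-≤ : ∀ o {C : Column n} → Sorted C → All (λ x → o ≤ rank x) C →
                  columnScore C ≤ maxScore o (length C)
  columnScore-≤ o {[]}    _   _          = z≤n
  columnScore-≤ o {x ∷ C} x↗C (o≤x ∷ _) =
    +-mono-≤ (∸-monoʳ-≤ n o≤x) (columnScore-≤ (suc o) (Linked.tail x↗C) (ranks-above o o≤x x↗C))

  columnScore-≡ : ∀ o {C : Column n} → Sorted C → All (λ x → o ≤ rank x) C → o + length C ≤ n →
                  columnScore C ≡ maxScore o (length C) → Initial o C
  columnScore-≡ o {[]}    _   _          _     _ = tt
  columnScore-≡ o {x ∷ C} x↗C (o≤x ∷ _) fits eq =
    rank≡o , columnScore-≡ (suc o) (Linked.tail x↗C) (ranks-above o o≤x x↗C) fits′ tail≡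
    where
    fits′ : suc o + length C ≤ n
    fits′ = subst (_≤ n) (+-suc o (length C)) fits
    headScore : n ∸ rank x ≤ n ∸ o
    headScore = ∸-monoʳ-≤ n o≤x
    tailScore : columnScore C ≤ maxScore (suc o) (length C)
    tailScore = columnScore-≤ (suc o) (Linked.tail x↗C) (ranks-above o o≤x x↗C)
    tail≡ : columnScore C ≡ maxScore (suc o) (length C)
    tail≡ = ≤-antisym tailScore (+-cancelˡ-≤ (n ∸ o) _ _ (≤-trans (≤-reflexive (sym eq)) (+-monoˡ-≤ (columnScore C) headScore)))
    rank≡o : rank x ≡ o
    rank≡o with m≤n⇒m<n∨m≡n o≤x
    ... | inj₂ o≡x = sym o≡x
    ... | inj₁ o<x = contradiction (trans eq (cong (n ∸ o +_) (sym tail≡)))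
                       (<⇒≢ (+-monoˡ-< (columnScore C) (∸-strictʳ (≤-trans (s≤s (m≤m+n o (length C))) fits′) o<x)))

  initial-≡ : ∀ o {C D : Column n} → Initial o C → Initial o D → length C ≡ length D → C ≡ D
  initial-≡ o {[]}    {[]}    _           _           _   = refl
  initial-≡ o {x ∷ C} {y ∷ D} (x≡o , C′) (y≡o , D′) len =
    cong₂ _∷_ (rank-injective x y (trans x≡o (sym y≡o))) (initial-≡ (suc o) C′ D′ (suc-injective len))

  initial-tableaux-≡ : ∀ {T U : Tableau n} → All (Initial 0) T → All (Initial 0) U → map length T ≡ map length U → T ≡ U
  initial-tableaux-≡ {[]}    {[]}    _        _        _   = refl
  initial-tableaux-≡ {C ∷ T} {D ∷ U} (c ∷ cs) (d ∷ ds) len =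
    cong₂ _∷_ (initial-≡ 0 c d (∷-injectiveˡ len)) (initial-tableaux-≡ cs ds (∷-injectiveʳ len))

  score-δ : ∀ (y : Letter n) → ∑[ i < n ] ((n ∸ toℕ i) * fromBool (pos i ==L y)) ≡ score y
  score-δ (pos j) = ∑-δ (λ i → n ∸ toℕ i) j
  score-δ (neg j) = trans (∑-zero {n} (λ i → *-zeroʳ (n ∸ toℕ i))) (sym (m≤n⇒m∸n≡0 (m≤m+n n _)))

  score-decomposition : ∀ (L : List (Letter n)) →
                        sum (map score L) ≡ ∑[ i < n ] ((n ∸ toℕ i) * countᵇ (pos i ==L_) L)
  score-decomposition []      = sym (∑-zero {n} (λ i → *-zeroʳ (n ∸ toℕ i)))
  score-decomposition (y ∷ L) = begin
    score y + sum (map score L)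
      ≡⟨ cong₂ _+_ (score-δ y) (sym (score-decomposition L)) ⟨
    ∑[ i < n ] (φ i * fromBool (pos i ==L y)) + ∑[ i < n ] (φ i * countᵇ (pos i ==L_) L)
      ≡⟨ ∑-distrib-+ (λ i → φ i * fromBool (pos i ==L y)) (λ i → φ i * countᵇ (pos i ==L_) L) ⟨
    ∑[ i < n ] (φ i * fromBool (pos i ==L y) + φ i * countᵇ (pos i ==L_) L)
      ≡⟨ sum-cong-≗ (λ i → trans (cong (φ i *_) (countᵇ-∷ (pos i ==L_) y L)) (*-distribˡ-+ (φ i) _ _)) ⟨
    ∑[ i < n ] (φ i * countᵇ (pos i ==L_) (y ∷ L)) ∎
    where
    open ≡-Reasoning
    φ : Fin n → ℕ
    φ i = n ∸ toℕ i

  score-concat : ∀ (T : Tableau n) → sum (map score (concat T)) ≡ sum (map columnScore T)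
  score-concat []      = refl
  score-concat (C ∷ T) = trans (cong sum (map-++ score C (concat T)))
    (trans (sum-++ (map score C) (map score (concat T))) (cong (columnScore C +_) (score-concat T)))

  weighted : ℕ → List ℕ → ℕ
  weighted o []      = 0
  weighted o (a ∷ l) = (n ∸ o) * a + weighted (suc o) l

  ∑-weighted : ∀ {m} o (l : Vec ℕ m) → ∑[ i < m ] ((n ∸ (o + toℕ i)) * Vec.lookup l i) ≡ weighted o (Vec.toList l)
  ∑-weighted o []      = refl
  ∑-weighted o (a ∷ l) = cong₂ _+_ (cong (λ k → (n ∸ k) * a) (+-identityʳ o))
    (trans (sum-cong-≗ (λ i → cong (λ k → (n ∸ k) * Vec.lookup l i) (+-suc o (toℕ i)))) (∑-weighted (suc o) l))

  maxScore-countᵇ-∷ : ∀ o j {a l} → Decreasing (a ∷ l) →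
                      maxScore o (countᵇ (j <ᵇ_) (a ∷ l)) ≡ (n ∸ o) * fromBool (j <ᵇ a) + maxScore (suc o) (countᵇ (j <ᵇ_) l)
  maxScore-countᵇ-∷ o j {a} {l} a∷l↘ with j <ᵇ a in j<a
  ... | true  = cong (_+ maxScore (suc o) (countᵇ (j <ᵇ_) l)) (sym (*-identityʳ (n ∸ o)))
  ... | false rewrite countᵇ-<-all≤ (All.map (λ b≤a → ≤-trans b≤a (<ᵇ≡false⇒≥ j<a)) (decreasing⇒head≥ a∷l↘))
    = sym (cong (_+ 0) (*-zeroʳ (n ∸ o)))

  weighted-conjugate : ∀ o M {l} → Decreasing l → All (_≤ M) l →
                       sum (applyUpTo (λ j → maxScore o (countᵇ (j <ᵇ_) l)) M) ≡ weighted o l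
  weighted-conjugate o M {[]}    _    _            = sum-applyUpTo-< M z≤n
  weighted-conjugate o M {a ∷ l} a∷l↘ (a≤M ∷ l≤M) = begin
    sum (applyUpTo (λ j → maxScore o (countᵇ (j <ᵇ_) (a ∷ l))) M)
      ≡⟨ cong sum (applyUpTo-cong (λ j → maxScore-countᵇ-∷ o j a∷l↘) M) ⟩
    sum (applyUpTo (λ j → (n ∸ o) * fromBool (j <ᵇ a) + maxScore (suc o) (countᵇ (j <ᵇ_) l)) M)
      ≡⟨ sum-applyUpTo-linear (n ∸ o) (λ j → fromBool (j <ᵇ a)) _ M ⟩
    (n ∸ o) * sum (applyUpTo (λ j → fromBool (j <ᵇ a)) M) + sum (applyUpTo (λ j → maxScore (suc o) (countᵇ (j <ᵇ_) l)) M)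
      ≡⟨ cong₂ (λ s t → (n ∸ o) * s + t) (sum-applyUpTo-< M a≤M) (weighted-conjugate (suc o) M (Linked.tail a∷l↘) l≤M) ⟩
    weighted o (a ∷ l) ∎
    where open ≡-Reasoning

module _ {n : ℕ} {λ' : Vec ℕ n} (partition : IsPartition λ') where

  initial-columns : ∀ {T : Tableau n} → Semistandard T → HasShape T λ' → weight T ≡ toℤ λ' → All (Initial 0) T
  initial-columns {T} (_ , T↗ , _) shape w =
    All.zipWith (λ {C} (C↗ , fits , eq) → columnScore-≡ 0 C↗ (All.universal (λ _ → z≤n) C) fits eq)
                (T↗ , All.zip (fits , equal-sums columnScore (maxScore 0 ∘ length) bounded total))
    where
    open ≤-Reasoning
    M : ℕ
    M = largestPart λ'
    bounded : All (λ C → columnScore C ≤ maxScore 0 (length C)) T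
    bounded = All.map (λ {C} C↗ → columnScore-≤ 0 C↗ (All.universal (λ _ → z≤n) C)) T↗
    fits : All (λ C → length C ≤ n) T
    fits = All.map⁻ (subst (All (_≤ n)) (sym shape) (All.map⁺ (All.universal
      (λ j → ≤-trans (length-filter (T? ∘ (j <ᵇ_)) (Vec.toList λ')) (≤-reflexive (Vec.length-toList λ'))) (upTo M))))
    λ≤count : ∀ i → Vec.lookup λ' i ≤ count (pos i) T
    λ≤count i = difference-≤ _ (count (neg i) T) _
      (trans (sym (lookup-weight T i)) (trans (cong (λ u → Vec.lookup u i) w) (Vec.lookup-map i ofℕ λ')))
    total : sum (map (maxScore 0 ∘ length) T) ≤ sum (map columnScore T)
    total = begin
      sum (map (maxScore 0 ∘ length) T)
        ≡⟨ cong sum (trans (map-∘ T) (cong (map (maxScore 0)) shape)) ⟩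
      sum (map (maxScore 0) (conjugate λ'))
        ≡⟨ cong sum (trans (cong (map (maxScore 0)) (map-applyUpTo (λ j → j) _ M)) (map-applyUpTo _ (maxScore 0) M)) ⟩
      sum (applyUpTo (λ j → maxScore 0 (countᵇ (j <ᵇ_) (Vec.toList λ'))) M)
        ≡⟨ weighted-conjugate 0 M (partition⇒decreasing λ' partition) (entries-≤-largestPart λ') ⟩
      weighted 0 (Vec.toList λ')
        ≡⟨ ∑-weighted 0 λ' ⟨
      ∑[ i < n ] ((n ∸ toℕ i) * Vec.lookup λ' i)
        ≤⟨ ∑-mono (λ i → *-monoʳ-≤ (n ∸ toℕ i) (λ≤count i)) ⟩
      ∑[ i < n ] ((n ∸ toℕ i) * count (pos i) T)
        ≡⟨ score-decomposition (concat T) ⟨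
      sum (map score (concat T))
        ≡⟨ score-concat T ⟩
      sum (map columnScore T) ∎

proposition2p16 : (n : ℕ) (λ' : Vec ℕ n) → IsPartition λ' →
    ((v : Vec ℤ n) → InOrbit (toℤ λ') v →
      Σ (Tableau n) (λ K → IsKey K × weight K ≡ v × HasShape K λ' ×
        ((K' : Tableau n) → IsKey K' → weight K' ≡ v → K' ≡ K)))
    × Σ (Tableau n) (λ K → IsKey K × weight K ≡ toℤ λ' ×
          ((T : Tableau n) → IsKN T → HasShape T λ' → weight T ≡ toℤ λ' → T ≡ K))
proposition2p16 n λ' partition with unique-key-in-orbit λ' here
... | K , K-key@((K-ss , _) , _) , K-weight , K-shape , _ =
  (λ v v∈ → unique-key-in-orbit λ' v∈) , K , K-key , K-weight , only-KN
  where
  only-KN : (T : Tableau n) → IsKN T → HasShape T λ' → weight T ≡ toℤ λ' → T ≡ K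
  only-KN T (T-ss , _) shape w =
    initial-tableaux-≡ (initial-columns partition T-ss shape w) (initial-columns partition K-ss K-shape K-weight)
                       (trans shape (sym K-shape))
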